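{- Let $K$ be a field of characteristic $0$, $\alpha\in K$ and $s\ge2$ an integer. Then \[ \Delta_1\big(R_{\alpha,1}(z)\big)=\frac{\alpha}{z(z+\alpha)},\qquad \Delta_1\big(R_{\alpha,s}(z)\big)=\frac{(-1)^s(s-1)!}{(z+\alpha)^s}, \] where the right-hand sides are expanded in $K((1/z))$.
   Context: $\Delta_1h(z)=h(z+1)-h(z)$ on $K((1/z))$ (shifted powers expanded in $1/z$). Modified inverse Mellin transform: for $g\in K[[z]]$, $g(e^z-1)=\sum_kb_kz^k/k!$, $\mathcal{M}^{ -1}(g)=\sum_kb_k(-1/z)^{k+1}$. With $(1+z)^\alpha=\sum_k\binom\alpha kz^k$, $\binom\alpha k=\alpha(\alpha-1)\cdots(\alpha-k+1)/k!$, and $\log(1+z)=\sum_{n\ge1}(-1)^{n-1}z^n/n$: $R_{\alpha,s}(z)=\mathcal{M}^{ -1}\big((1+z)^\alpha\log^{s-1}(1+z)/z\big)$ for $s\ge2$ and $R_{\alpha,1}(z)=\mathcal{M}^{ -1}\big(((1+z)^\alpha-1)/z\big)$. -}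

module Defs where

open import Level using (_⊔_) renaming (suc to lsuc)
open import Data.Nat using (ℕ; zero; suc; _∸_)
open import Data.Nat using () renaming (_*_ to _*ℕ_)
open import Data.Nat using (_!)
open import Algebra.Bundles using (CommutativeRing)
open import Relation.Nullary using (¬_)

-- A field: a commutative ring with 1 ≉ 0 and a (total) inverse operation
-- that is a two-sided inverse on nonzero elements (its value at 0 is irrelevant).
record Field c ℓ : Set (lsuc (c ⊔ ℓ)) where
  field
    commutativeRing : CommutativeRing c ℓ
  open CommutativeRing commutativeRing public
  infix 8 _⁻¹
  field
    _⁻¹        : Carrier → Carrier
    1≉0        : ¬ (1# ≈ 0#)
    ⁻¹-inverse : ∀ x → ¬ (x ≈ 0#) → x * (x ⁻¹) ≈ 1#

module Series {c ℓ} (F : Field c ℓ) where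
  open Field F

  ι : ℕ → Carrier
  ι zero    = 0#
  ι (suc n) = 1# + ι n

  CharZero : Set ℓ
  CharZero = ∀ n → ¬ (ι (suc n) ≈ 0#)

  pw : Carrier → ℕ → Carrier
  pw x zero    = 1#
  pw x (suc n) = x * pw x n

  sgn : ℕ → Carrier
  sgn = pw (- 1#)

  Σ< : ℕ → (ℕ → Carrier) → Carrier
  Σ< zero    f = 0#
  Σ< (suc n) f = Σ< n f + f n

  Π< : ℕ → (ℕ → Carrier) → Carrier
  Π< zero    f = 1#
  Π< (suc n) f = Π< n f * f n

  binom : Carrier → ℕ → Carrier
  binom a k = Π< k (λ i → a - ι i) * (ι (k !)) ⁻¹

  Ser : Set c
  Ser = ℕ → Carrier

  _≋_ : Ser → Ser → Set ℓ
  f ≋ g = ∀ n → f n ≈ g n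

  _⊕_ : Ser → Ser → Ser
  (f ⊕ g) n = f n + g n

  _⊖_ : Ser → Ser → Ser
  (f ⊖ g) n = f n - g n

  _⊙_ : Ser → Ser → Ser
  (f ⊙ g) n = Σ< (suc n) (λ i → f i * g (n ∸ i))

  one : Ser
  one zero    = 1#
  one (suc n) = 0#

  spow : Ser → ℕ → Ser
  spow f zero    = one
  spow f (suc k) = f ⊙ spow f k

  -- composition g(f) (used only for f with zero constant term)
  comp : Ser → Ser → Ser
  comp g f n = Σ< (suc n) (λ k → g k * spow f k n)

  -- division by the variable (used only for series with zero constant term)
  divX : Ser → Ser
  divX f n = f (suc n)

  mulX : ℕ → Ser → Ser
  mulX zero    f n       = f n
  mulX (suc m) f zero    = 0#
  mulX (suc m) f (suc n) = mulX m f n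

  expm1 : Ser
  expm1 zero    = 0#
  expm1 (suc n) = (ι (suc n !)) ⁻¹

  binSer : Carrier → Ser
  binSer a k = binom a k

  logSer : Ser
  logSer zero    = 0#
  logSer (suc n) = sgn n * (ι (suc n)) ⁻¹

  -- b_k with g(e^z - 1) = Σ b_k z^k / k!
  bco : Ser → ℕ → Carrier
  bco g k = ι (k !) * comp g expm1 k

  -- Elements of K((1/z)) with no nonnegative powers of z beyond z^0 are
  -- represented as power series in w = 1/z (coefficient n ↦ coefficient of z^(-n)).
  -- Modified inverse Mellin transform: M⁻¹(g) = Σ_k b_k (-1/z)^(k+1).
  Minv : Ser → Ser
  Minv g zero    = 0#
  Minv g (suc k) = sgn (suc k) * bco g k

  R₁ : Carrier → Ser
  R₁ a = Minv (divX (binSer a ⊖ one))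

  R : Carrier → ℕ → Ser
  R a s = Minv (divX (binSer a ⊙ spow logSer (s ∸ 1)))

  -- 1/(z+1) = w/(1+w) in terms of w = 1/z
  shiftW : Ser
  shiftW zero    = 0#
  shiftW (suc j) = sgn j

  -- Δ₁ h (z) = h(z+1) - h(z)
  Δ₁ : Ser → Ser
  Δ₁ h = comp h shiftW ⊖ h

  binScaled : Carrier → Carrier → Ser
  binScaled b a j = binom b j * pw a j

  -- α / (z (z+α)) = α w² (1 + α w)^(-1), expanded in 1/z
  rhs₁ : Carrier → Ser
  rhs₁ a = mulX 2 (λ j → a * binScaled (- 1#) a j)

  -- (-1)^s (s-1)! / (z+α)^s = (-1)^s (s-1)! w^s (1 + α w)^(-s), expanded in 1/z
  rhs : Carrier → ℕ → Ser
  rhs a s = mulX s (λ j → (sgn s * ι ((s ∸ 1) !)) * binScaled (- ι s) a j)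

-- With w = 1/z, the shift z ↦ z + 1 is composition with w/(1 + w), whose (j+1)-st power has the
-- signed binomial coefficients (−1)^d C(j+d, j). Feeding these into M⁻¹(g) = Σ b_k (−w)^(k+1), the
-- binomials recombine into factorials and give Δ₁ ∘ M⁻¹ = M⁻¹ ∘ (multiplication by z), because the
-- b_k of z g come from (e^z − 1) g(e^z − 1). Hence Δ₁ R_{α,s} = M⁻¹((1+z)^α log^(s−1)(1+z)), and
-- Δ₁ R_{α,1} = M⁻¹((1+z)^α − 1). The substitution z ↦ e^z − 1 turns θ = (1+z) d/dz into d/dz; as
-- θ multiplies (1+z)^α by α and lowers powers of log(1+z), (1+z)^α log^m(1+z) becomes e^{αz} z^m,
-- whose coefficients α^j/j! in degree m+j make M⁻¹ the expansion of (−1)^s (s−1)!/(z+α)^s.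

module Submission where

open import Defs
open import Data.Nat using (ℕ; _≤_)
open import Data.Product using (_×_)
open import Data.Nat as Nat using (zero; suc; _∸_; _<_; _!; z≤n; s≤s)
import Data.Nat.Properties as ℕₚ
open import Data.Product using (_,_)
open import Data.Sum using (inj₁; inj₂)
open import Data.Maybe using (nothing)
open import Relation.Nullary using (¬_; yes; no; contradiction)
open import Relation.Binary.PropositionalEquality as ≡ using (_≡_)

-- binomial j d = C(j + d, j), generated by Pascal's rule.
binomial : ℕ → ℕ → ℕ
binomial zero    d       = 1
binomial (suc j) zero    = 1
binomial (suc j) (suc d) = binomial j (suc d) Nat.+ binomial (suc j) d

binomial-! : ∀ j d → binomial j d Nat.* (j ! Nat.* d !) ≡ (j Nat.+ d) !
binomial-! zero    d       = ≡.trans (ℕₚ.*-identityˡ _) (ℕₚ.*-identityˡ _)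
binomial-! (suc j) zero    =
  ≡.trans (ℕₚ.*-identityˡ _) (≡.trans (ℕₚ.*-identityʳ _) (≡.cong _! (≡.sym (ℕₚ.+-identityʳ (suc j)))))
binomial-! (suc j) (suc d) = begin
  (a + b) * ((suc j * j!) * (suc d * d!))
    ≡⟨ solve 6 (λ a b j! d! j d → (a :+ b) :* (((con 1 :+ j) :* j!) :* ((con 1 :+ d) :* d!))
                 := (con 1 :+ j) :* (a :* (j! :* ((con 1 :+ d) :* d!))) :+ (con 1 :+ d) :* (b :* (((con 1 :+ j) :* j!) :* d!)))
               ≡.refl a b j! d! j d ⟩
  suc j * (a * (j! * (suc d * d!))) + suc d * (b * ((suc j * j!) * d!))
    ≡⟨ ≡.cong₂ (λ x y → suc j * x + suc d * y) (binomial-! j (suc d)) (binomial-! (suc j) d) ⟩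
  suc j * (j + suc d) ! + suc d * (suc j + d) !
    ≡⟨ ≡.cong (λ k → suc j * (j + suc d) ! + suc d * k !) (≡.sym (ℕₚ.+-suc j d)) ⟩
  suc j * (j + suc d) ! + suc d * (j + suc d) !
    ≡⟨ solve 3 (λ j d y → (con 1 :+ j) :* y :+ (con 1 :+ d) :* y := (con 1 :+ j :+ (con 1 :+ d)) :* y)
               ≡.refl j d ((j + suc d) !) ⟩
  (suc j + suc d) * (j + suc d) ! ∎
  where
  open Nat using (_+_; _*_)
  open ≡.≡-Reasoning
  open import Data.Nat.Solver using (module +-*-Solver)
  open +-*-Solver
  a = binomial j (suc d)
  b = binomial (suc j) d
  j! = j !
  d! = d !

module SeriesCalculus {c ℓ} (F : Field c ℓ) where
  open Field F hiding (zero)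
  open Series F
  open import Algebra.Properties.Ring ring using (-1*x≈-x; -‿involutive; -0#≈0#)
  open import Relation.Binary.Reasoning.Setoid setoid
  open import Algebra.Solver.Ring.NaturalCoefficients commutativeSemiring (λ _ _ → nothing)
    using (solve; _:+_; _:*_; _:=_; con)

  -- The solver only knows semiring laws, so negation is handled by treating - 1# as an atom.
  -1*x+x≈0 : ∀ x → - 1# * x + x ≈ 0#
  -1*x+x≈0 x = trans (+-congʳ (-1*x≈-x x)) (-‿inverseˡ x)

  x-y≈x+-1*y : ∀ x y → x - y ≈ x + - 1# * y
  x-y≈x+-1*y x y = +-congˡ (sym (-1*x≈-x y))

  [x+y]-y≈x : ∀ x y → (x + y) - y ≈ x
  [x+y]-y≈x x y = trans (+-assoc x y (- y)) (trans (+-congˡ (-‿inverseʳ y)) (+-identityʳ x))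

  x+y≈z⇒x≈z-y : ∀ {x y z} → x + y ≈ z → x ≈ z - y
  x+y≈z⇒x≈z-y {x} {y} x+y≈z = trans (sym ([x+y]-y≈x x y)) (+-congʳ x+y≈z)

  ⁻¹-inverseˡ : ∀ x → ¬ (x ≈ 0#) → x ⁻¹ * x ≈ 1#
  ⁻¹-inverseˡ x x≉0 = trans (*-comm _ _) (⁻¹-inverse x x≉0)

  *-cancelˡ : ∀ x {y z} → ¬ (x ≈ 0#) → x * y ≈ x * z → y ≈ z
  *-cancelˡ x {y} {z} x≉0 xy≈xz = begin
    y                 ≈⟨ sym (*-identityˡ y) ⟩
    1# * y            ≈⟨ *-congʳ (sym (⁻¹-inverseˡ x x≉0)) ⟩
    (x ⁻¹ * x) * y    ≈⟨ *-assoc _ _ _ ⟩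
    x ⁻¹ * (x * y)    ≈⟨ *-congˡ xy≈xz ⟩
    x ⁻¹ * (x * z)    ≈⟨ *-assoc _ _ _ ⟨
    (x ⁻¹ * x) * z    ≈⟨ *-congʳ (⁻¹-inverseˡ x x≉0) ⟩
    1# * z            ≈⟨ *-identityˡ z ⟩
    z                 ∎

  ⁻¹-unique : ∀ x {y} → ¬ (x ≈ 0#) → x * y ≈ 1# → y ≈ x ⁻¹
  ⁻¹-unique x x≉0 xy≈1 = *-cancelˡ x x≉0 (trans xy≈1 (sym (⁻¹-inverse x x≉0)))

  ι-homo-+ : ∀ m n → ι (m Nat.+ n) ≈ ι m + ι n
  ι-homo-+ zero    n = sym (+-identityˡ _)
  ι-homo-+ (suc m) n = trans (+-congˡ (ι-homo-+ m n)) (sym (+-assoc _ _ _))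

  ι-homo-* : ∀ m n → ι (m Nat.* n) ≈ ι m * ι n
  ι-homo-* zero    n = sym (zeroˡ _)
  ι-homo-* (suc m) n = begin
    ι (n Nat.+ m Nat.* n)     ≈⟨ ι-homo-+ n (m Nat.* n) ⟩
    ι n + ι (m Nat.* n)     ≈⟨ +-congˡ (ι-homo-* m n) ⟩
    ι n + ι m * ι n       ≈⟨ solve 2 (λ x y → y :+ x :* y := (con 1 :+ x) :* y) refl (ι m) (ι n) ⟩
    (1# + ι m) * ι n      ∎

  ι1≈1 : ι 1 ≈ 1#
  ι1≈1 = +-identityʳ 1#

  ι-binomial-! : ∀ j d → ι (binomial j d) * (ι (j !) * ι (d !)) ≈ ι ((j Nat.+ d) !)
  ι-binomial-! j d = begin
    ι (binomial j d) * (ι (j !) * ι (d !))   ≈⟨ *-congˡ (ι-homo-* (j !) (d !)) ⟨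
    ι (binomial j d) * ι (j ! Nat.* d !)     ≈⟨ ι-homo-* (binomial j d) (j ! Nat.* d !) ⟨
    ι (binomial j d Nat.* (j ! Nat.* d !))   ≈⟨ reflexive (≡.cong ι (binomial-! j d)) ⟩
    ι ((j Nat.+ d) !)                        ∎

  pw-homo-+ : ∀ x m n → pw x (m Nat.+ n) ≈ pw x m * pw x n
  pw-homo-+ x zero    n = sym (*-identityˡ _)
  pw-homo-+ x (suc m) n = trans (*-congˡ (pw-homo-+ x m n)) (sym (*-assoc _ _ _))

  sgn-homo-+ : ∀ m n → sgn (m Nat.+ n) ≈ sgn m * sgn n
  sgn-homo-+ = pw-homo-+ (- 1#)

  sgn-suc-suc : ∀ n → sgn (suc (suc n)) ≈ sgn n
  sgn-suc-suc n = trans (-1*x≈-x _) (trans (-‿cong (-1*x≈-x _)) (-‿involutive _))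

  Σ-cong : ∀ n {f g : ℕ → Carrier} → (∀ i → i < n → f i ≈ g i) → Σ< n f ≈ Σ< n g
  Σ-cong zero    f≈g = refl
  Σ-cong (suc n) f≈g = +-cong (Σ-cong n (λ i i<n → f≈g i (ℕₚ.m<n⇒m<1+n i<n))) (f≈g n (ℕₚ.n<1+n n))

  Σ-zero : ∀ n (f : ℕ → Carrier) → (∀ i → i < n → f i ≈ 0#) → Σ< n f ≈ 0#
  Σ-zero zero    f f≈0 = refl
  Σ-zero (suc n) f f≈0 =
    trans (+-cong (Σ-zero n f (λ i i<n → f≈0 i (ℕₚ.m<n⇒m<1+n i<n))) (f≈0 n (ℕₚ.n<1+n n))) (+-identityʳ 0#)

  Σ-distrib-+ : ∀ n (f g : ℕ → Carrier) → Σ< n (λ i → f i + g i) ≈ Σ< n f + Σ< n g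
  Σ-distrib-+ zero    f g = sym (+-identityʳ 0#)
  Σ-distrib-+ (suc n) f g = trans (+-congʳ (Σ-distrib-+ n f g))
    (solve 4 (λ a b c d → (a :+ b) :+ (c :+ d) := (a :+ c) :+ (b :+ d)) refl _ _ _ _)

  *-distribˡ-Σ : ∀ n x (f : ℕ → Carrier) → x * Σ< n f ≈ Σ< n (λ i → x * f i)
  *-distribˡ-Σ zero    x f = zeroʳ x
  *-distribˡ-Σ (suc n) x f = trans (distribˡ x _ _) (+-congʳ (*-distribˡ-Σ n x f))

  Σ-unfoldˡ : ∀ n (f : ℕ → Carrier) → Σ< (suc n) f ≈ f 0 + Σ< n (λ i → f (suc i))
  Σ-unfoldˡ zero    f = trans (+-identityˡ _) (sym (+-identityʳ _))
  Σ-unfoldˡ (suc n) f = trans (+-congʳ (Σ-unfoldˡ n f)) (+-assoc _ _ _)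

  Σ-dropˡ : ∀ n (f : ℕ → Carrier) → f 0 ≈ 0# → Σ< (suc n) f ≈ Σ< n (λ i → f (suc i))
  Σ-dropˡ n f f0≈0 = trans (Σ-unfoldˡ n f) (trans (+-congʳ f0≈0) (+-identityˡ _))

  Σ-dropʳ : ∀ n (f : ℕ → Carrier) → f n ≈ 0# → Σ< (suc n) f ≈ Σ< n f
  Σ-dropʳ n f fn≈0 = trans (+-congˡ fn≈0) (+-identityʳ _)

  Σ-comm : ∀ m n (f : ℕ → ℕ → Carrier) →
           Σ< m (λ i → Σ< n (λ k → f i k)) ≈ Σ< n (λ k → Σ< m (λ i → f i k))
  Σ-comm zero    n f = sym (Σ-zero n _ (λ _ _ → refl))
  Σ-comm (suc m) n f = trans (+-congʳ (Σ-comm m n f)) (sym (Σ-distrib-+ n _ _))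

  Σ-reverse : ∀ n (f : ℕ → Carrier) → Σ< n f ≈ Σ< n (λ i → f (n ∸ suc i))
  Σ-reverse zero    f = refl
  Σ-reverse (suc n) f = begin
    Σ< n f + f n                        ≈⟨ +-congʳ (Σ-reverse n f) ⟩
    Σ< n (λ i → f (n ∸ suc i)) + f n    ≈⟨ +-comm _ _ ⟩
    f n + Σ< n (λ i → f (n ∸ suc i))    ≈⟨ Σ-unfoldˡ n (λ i → f (n ∸ i)) ⟨
    Σ< (suc n) (λ i → f (n ∸ i))        ∎

  Π-cong : ∀ n {f g : ℕ → Carrier} → (∀ i → f i ≈ g i) → Π< n f ≈ Π< n g
  Π-cong zero    f≈g = refl
  Π-cong (suc n) f≈g = *-cong (Π-cong n f≈g) (f≈g n)

  rising : Carrier → ℕ → Carrier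
  rising x j = Π< j (λ i → x + ι i)

  Π-negate : ∀ x j → Π< j (λ i → - x - ι i) ≈ sgn j * rising x j
  Π-negate x zero    = sym (*-identityˡ 1#)
  Π-negate x (suc j) = begin
    Π< j (λ i → - x - ι i) * (- x - ι j)
      ≈⟨ *-cong (Π-negate x j) (trans (+-cong (sym (-1*x≈-x x)) (sym (-1*x≈-x (ι j)))) (sym (distribˡ (- 1#) x (ι j)))) ⟩
    (sgn j * rising x j) * (- 1# * (x + ι j))
      ≈⟨ solve 4 (λ s p a y → (s :* p) :* (a :* y) := (a :* s) :* (p :* y)) refl _ _ _ _ ⟩
    sgn (suc j) * rising x (suc j)
      ∎

  ι-!-*-rising : ∀ m j → ι (m !) * rising (ι (suc m)) j ≈ ι ((m Nat.+ j) !)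
  ι-!-*-rising m zero    = trans (*-identityʳ _) (reflexive (≡.cong (λ k → ι (k !)) (≡.sym (ℕₚ.+-identityʳ m))))
  ι-!-*-rising m (suc j) = begin
    ι (m !) * (rising (ι (suc m)) j * (ι (suc m) + ι j))
      ≈⟨ *-assoc _ _ _ ⟨
    (ι (m !) * rising (ι (suc m)) j) * (ι (suc m) + ι j)
      ≈⟨ *-cong (ι-!-*-rising m j) (sym (ι-homo-+ (suc m) j)) ⟩
    ι ((m Nat.+ j) !) * ι (suc m Nat.+ j)
      ≈⟨ trans (*-comm _ _) (sym (ι-homo-* (suc m Nat.+ j) ((m Nat.+ j) !))) ⟩
    ι (suc (m Nat.+ j) !)
      ≈⟨ reflexive (≡.cong (λ k → ι (k !)) (≡.sym (ℕₚ.+-suc m j))) ⟩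
    ι ((m Nat.+ suc j) !)
      ∎

  infixr 7 _·_

  _·_ : Carrier → Ser → Ser
  (a · f) n = a * f n

  ∂ : Ser → Ser
  ∂ f n = ι (suc n) * f (suc n)

  θ : Ser → Ser
  θ f = ∂ f ⊕ mulX 1 (∂ f)

  ≋-trans : ∀ {f g h} → f ≋ g → g ≋ h → f ≋ h
  ≋-trans f≋g g≋h n = trans (f≋g n) (g≋h n)

  ⊕-cong : ∀ {f f′ g g′} → f ≋ f′ → g ≋ g′ → (f ⊕ g) ≋ (f′ ⊕ g′)
  ⊕-cong f≋f′ g≋g′ n = +-cong (f≋f′ n) (g≋g′ n)

  mulX1-cong : ∀ {f g} → f ≋ g → mulX 1 f ≋ mulX 1 g
  mulX1-cong f≋g zero    = refl
  mulX1-cong f≋g (suc n) = f≋g n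

  ∂-cong : ∀ {f g} → f ≋ g → ∂ f ≋ ∂ g
  ∂-cong f≋g n = *-congˡ (f≋g (suc n))

  θ-cong : ∀ {f g} → f ≋ g → θ f ≋ θ g
  θ-cong f≋g = ⊕-cong (∂-cong f≋g) (mulX1-cong (∂-cong f≋g))

  ⊙-cong : ∀ {f f′ g g′} → f ≋ f′ → g ≋ g′ → (f ⊙ g) ≋ (f′ ⊙ g′)
  ⊙-cong f≋f′ g≋g′ n = Σ-cong (suc n) (λ i _ → *-cong (f≋f′ i) (g≋g′ (n ∸ i)))

  ⊙-distribʳ-⊕ : ∀ f g h → ((f ⊕ g) ⊙ h) ≋ ((f ⊙ h) ⊕ (g ⊙ h))
  ⊙-distribʳ-⊕ f g h n = trans (Σ-cong (suc n) (λ i _ → distribʳ _ _ _)) (Σ-distrib-+ (suc n) _ _)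

  ⊙-distribˡ-⊕ : ∀ f g h → (f ⊙ (g ⊕ h)) ≋ ((f ⊙ g) ⊕ (f ⊙ h))
  ⊙-distribˡ-⊕ f g h n = trans (Σ-cong (suc n) (λ i _ → distribˡ _ _ _)) (Σ-distrib-+ (suc n) _ _)

  ·-⊙ : ∀ a f g → ((a · f) ⊙ g) ≋ (a · (f ⊙ g))
  ·-⊙ a f g n = sym (trans (*-distribˡ-Σ (suc n) a _) (Σ-cong (suc n) (λ i _ → sym (*-assoc _ _ _))))

  ⊙-· : ∀ a f g → (f ⊙ (a · g)) ≋ (a · (f ⊙ g))
  ⊙-· a f g n = sym (trans (*-distribˡ-Σ (suc n) a _) (Σ-cong (suc n) (λ i _ →
    solve 3 (λ a x y → a :* (x :* y) := x :* (a :* y)) refl a _ _)))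

  ⊙-identityˡ : ∀ f → (one ⊙ f) ≋ f
  ⊙-identityˡ f n = begin
    Σ< (suc n) (λ i → one i * f (n ∸ i))              ≈⟨ Σ-unfoldˡ n _ ⟩
    1# * f n + Σ< n (λ i → 0# * f (n ∸ suc i))        ≈⟨ +-cong (*-identityˡ _) (Σ-zero n _ (λ i _ → zeroˡ _)) ⟩
    f n + 0#                                          ≈⟨ +-identityʳ _ ⟩
    f n                                               ∎

  ⊙-identityʳ : ∀ f → (f ⊙ one) ≋ f
  ⊙-identityʳ f n = begin
    Σ< n (λ i → f i * one (n ∸ i)) + f n * one (n ∸ n)
      ≈⟨ +-cong (Σ-zero n _ off-diagonal) (*-congˡ (reflexive (≡.cong one (ℕₚ.n∸n≡0 n)))) ⟩
    0# + f n * 1#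
      ≈⟨ trans (+-identityˡ _) (*-identityʳ _) ⟩
    f n
      ∎
    where
    off-diagonal : ∀ i → i < n → f i * one (n ∸ i) ≈ 0#
    off-diagonal i i<n with n ∸ i | ℕₚ.m>n⇒m∸n≢0 i<n
    ... | zero  | n∸i≢0 = contradiction ≡.refl n∸i≢0
    ... | suc _ | _     = zeroʳ _

  mulX1-⊕ : ∀ f g → mulX 1 (f ⊕ g) ≋ (mulX 1 f ⊕ mulX 1 g)
  mulX1-⊕ f g zero    = sym (+-identityʳ _)
  mulX1-⊕ f g (suc n) = refl

  mulX1-⊙ : ∀ f g → (mulX 1 f ⊙ g) ≋ mulX 1 (f ⊙ g)
  mulX1-⊙ f g zero    = trans (+-identityˡ _) (zeroˡ _)
  mulX1-⊙ f g (suc n) = Σ-dropˡ (suc n) _ (zeroˡ _)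

  ⊙-mulX1 : ∀ f g → (f ⊙ mulX 1 g) ≋ mulX 1 (f ⊙ g)
  ⊙-mulX1 f g zero    = trans (+-identityˡ _) (zeroʳ _)
  ⊙-mulX1 f g (suc n) = begin
    Σ< (suc (suc n)) (λ i → f i * mulX 1 g (suc n ∸ i))
      ≈⟨ Σ-dropʳ (suc n) _ (trans (*-congˡ (reflexive (≡.cong (mulX 1 g) (ℕₚ.n∸n≡0 n)))) (zeroʳ _)) ⟩
    Σ< (suc n) (λ i → f i * mulX 1 g (suc n ∸ i))
      ≈⟨ Σ-cong (suc n) (λ i i≤n → reflexive (≡.cong (λ k → f i * mulX 1 g k) (ℕₚ.+-∸-assoc 1 (ℕₚ.≤-pred i≤n)))) ⟩
    Σ< (suc n) (λ i → f i * g (n ∸ i))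
      ∎

  mulX1-divX : ∀ f → f 0 ≈ 0# → mulX 1 (divX f) ≋ f
  mulX1-divX f f0≈0 zero    = sym f0≈0
  mulX1-divX f f0≈0 (suc n) = refl

  mulX-below : ∀ m f n → n < m → mulX m f n ≈ 0#
  mulX-below (suc m) f zero    _         = refl
  mulX-below (suc m) f (suc n) (s≤s n<m) = mulX-below m f n n<m

  mulX-+ : ∀ m f j → mulX m f (m Nat.+ j) ≡ f j
  mulX-+ zero    f j = ≡.refl
  mulX-+ (suc m) f j = mulX-+ m f j

  ∂-leibniz : ∀ f g → ∂ (f ⊙ g) ≋ ((∂ f ⊙ g) ⊕ (f ⊙ ∂ g))
  ∂-leibniz f g n = begin
    ι (suc n) * Σ< (suc (suc n)) t
      ≈⟨ *-distribˡ-Σ (suc (suc n)) _ _ ⟩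
    Σ< (suc (suc n)) (λ i → ι (suc n) * t i)
      ≈⟨ Σ-cong (suc (suc n)) split ⟩
    Σ< (suc (suc n)) (λ i → ι i * t i + ι (suc n ∸ i) * t i)
      ≈⟨ Σ-distrib-+ (suc (suc n)) _ _ ⟩
    Σ< (suc (suc n)) (λ i → ι i * t i) + Σ< (suc (suc n)) (λ i → ι (suc n ∸ i) * t i)
      ≈⟨ +-cong ∂-on-f ∂-on-g ⟩
    (∂ f ⊙ g) n + (f ⊙ ∂ g) n
      ∎
    where
    t : ℕ → Carrier
    t i = f i * g (suc n ∸ i)
    split : ∀ i → i < suc (suc n) → ι (suc n) * t i ≈ ι i * t i + ι (suc n ∸ i) * t i
    split i i<2+n = trans (*-congʳ (trans (reflexive (≡.cong ι (≡.sym (ℕₚ.m+[n∸m]≡n (ℕₚ.≤-pred i<2+n)))))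
                                          (ι-homo-+ i (suc n ∸ i))))
                          (distribʳ _ _ _)
    ∂-on-f : Σ< (suc (suc n)) (λ i → ι i * t i) ≈ (∂ f ⊙ g) n
    ∂-on-f = trans (Σ-dropˡ (suc n) _ (zeroˡ _)) (Σ-cong (suc n) (λ i _ → sym (*-assoc _ _ _)))
    ∂-on-g : Σ< (suc (suc n)) (λ i → ι (suc n ∸ i) * t i) ≈ (f ⊙ ∂ g) n
    ∂-on-g = trans (Σ-dropʳ (suc n) _ (trans (*-congʳ (reflexive (≡.cong ι (ℕₚ.n∸n≡0 n)))) (zeroˡ _)))
      (Σ-cong (suc n) (λ i i≤n →
        trans (reflexive (≡.cong (λ k → ι k * (f i * g k)) (ℕₚ.+-∸-assoc 1 (ℕₚ.≤-pred i≤n))))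
              (solve 3 (λ a x y → a :* (x :* y) := x :* (a :* y)) refl _ _ _)))

  θ-leibniz : ∀ f g → θ (f ⊙ g) ≋ ((θ f ⊙ g) ⊕ (f ⊙ θ g))
  θ-leibniz f g n = begin
    θ (f ⊙ g) n
      ≈⟨ +-cong (∂-leibniz f g n) (trans (mulX1-cong (∂-leibniz f g) n) (mulX1-⊕ _ _ n)) ⟩
    ((∂ f ⊙ g) n + (f ⊙ ∂ g) n) + (mulX 1 (∂ f ⊙ g) n + mulX 1 (f ⊙ ∂ g) n)
      ≈⟨ solve 4 (λ a b c d → (a :+ b) :+ (c :+ d) := (a :+ c) :+ (b :+ d)) refl _ _ _ _ ⟩
    ((∂ f ⊙ g) n + mulX 1 (∂ f ⊙ g) n) + ((f ⊙ ∂ g) n + mulX 1 (f ⊙ ∂ g) n)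
      ≈⟨ +-cong (+-congˡ (sym (mulX1-⊙ (∂ f) g n))) (+-congˡ (sym (⊙-mulX1 f (∂ g) n))) ⟩
    ((∂ f ⊙ g) n + (mulX 1 (∂ f) ⊙ g) n) + ((f ⊙ ∂ g) n + (f ⊙ mulX 1 (∂ g)) n)
      ≈⟨ +-cong (sym (⊙-distribʳ-⊕ (∂ f) (mulX 1 (∂ f)) g n)) (sym (⊙-distribˡ-⊕ f (∂ g) (mulX 1 (∂ g)) n)) ⟩
    (θ f ⊙ g) n + (f ⊙ θ g) n
      ∎

  θ-spow : ∀ {f} → θ f ≋ one → ∀ m → θ (spow f (suc m)) ≋ (ι (suc m) · spow f m)
  θ-spow {f} θf≋1 zero n = begin
    θ (f ⊙ one) n    ≈⟨ θ-cong (⊙-identityʳ f) n ⟩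
    θ f n            ≈⟨ θf≋1 n ⟩
    one n            ≈⟨ trans (*-congʳ ι1≈1) (*-identityˡ _) ⟨
    ι 1 * one n      ∎
  θ-spow {f} θf≋1 (suc m) n = begin
    θ (f ⊙ fᵐ⁺¹) n
      ≈⟨ θ-leibniz f fᵐ⁺¹ n ⟩
    (θ f ⊙ fᵐ⁺¹) n + (f ⊙ θ fᵐ⁺¹) n
      ≈⟨ +-cong (trans (⊙-cong {θ f} {one} {fᵐ⁺¹} θf≋1 (λ _ → refl) n) (⊙-identityˡ fᵐ⁺¹ n))
                (trans (⊙-cong {g = θ fᵐ⁺¹} {ι (suc m) · spow f m} (λ _ → refl) (θ-spow θf≋1 m) n)
                       (⊙-· (ι (suc m)) f (spow f m) n)) ⟩
    fᵐ⁺¹ n + ι (suc m) * fᵐ⁺¹ n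
      ≈⟨ solve 2 (λ a c → a :+ c :* a := (con 1 :+ c) :* a) refl _ _ ⟩
    ι (suc (suc m)) * fᵐ⁺¹ n
      ∎
    where fᵐ⁺¹ = spow f (suc m)

  θ-⊙-eigen : ∀ {a b} → θ b ≋ (a · b) → ∀ g → θ (b ⊙ g) ≋ ((a · (b ⊙ g)) ⊕ (b ⊙ θ g))
  θ-⊙-eigen {a} {b} θb≋ab g n =
    trans (θ-leibniz b g n) (+-congʳ (trans (⊙-cong {θ b} {a · b} {g} θb≋ab (λ _ → refl) n) (·-⊙ a b g n)))

  comp-congˡ : ∀ {f g} e → f ≋ g → comp f e ≋ comp g e
  comp-congˡ e f≋g n = Σ-cong (suc n) (λ i _ → *-congʳ (f≋g i))

  comp-distrib-⊕ : ∀ f g e → comp (f ⊕ g) e ≋ (comp f e ⊕ comp g e)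
  comp-distrib-⊕ f g e n = trans (Σ-cong (suc n) (λ i _ → distribʳ _ _ _)) (Σ-distrib-+ (suc n) _ _)

  comp-· : ∀ a f e → comp (a · f) e ≋ (a · comp f e)
  comp-· a f e n = sym (trans (*-distribˡ-Σ (suc n) a _) (Σ-cong (suc n) (λ i _ → sym (*-assoc _ _ _))))

  comp-at-0 : ∀ g e → comp g e 0 ≈ g 0
  comp-at-0 g e = trans (+-identityˡ _) (*-identityʳ _)

  comp-one : ∀ e → comp one e ≋ one
  comp-one e n = trans (Σ-unfoldˡ n _) (trans (+-cong (*-identityˡ _) (Σ-zero n _ (λ i _ → zeroˡ _))) (+-identityʳ _))

  spow-below : ∀ e → e 0 ≈ 0# → ∀ k n → n < k → spow e k n ≈ 0#
  spow-below e e0≈0 (suc k) n n<1+k = Σ-zero (suc n) _ (term n n<1+k)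
    where
    term : ∀ m → m < suc k → ∀ i → i < suc m → e i * spow e k (m ∸ i) ≈ 0#
    term m       _         zero    _         = trans (*-congʳ e0≈0) (zeroˡ _)
    term zero    _         (suc i) (s≤s ())
    term (suc m) (s≤s m<k) (suc i) _         =
      trans (*-congˡ (spow-below e e0≈0 k (m ∸ i) (ℕₚ.≤-<-trans (ℕₚ.m∸n≤m m i) m<k))) (zeroʳ _)

  module _ (e : Ser) (e0≈0 : e 0 ≈ 0#) where

    comp-truncate : ∀ g m N → m < N → Σ< N (λ k → g k * spow e k m) ≈ comp g e m
    comp-truncate g m (suc N) m<1+N with ℕₚ.m≤n⇒m<n∨m≡n (ℕₚ.≤-pred m<1+N)
    ... | inj₂ ≡.refl = refl
    ... | inj₁ m<N    =
      trans (Σ-dropʳ N _ (trans (*-congˡ (spow-below e e0≈0 N m m<N)) (zeroʳ _))) (comp-truncate g m N m<N)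

    comp-mulX1 : ∀ g → comp (mulX 1 g) e ≋ (comp g e ⊙ e)
    comp-mulX1 g m = begin
      Σ< (suc m) (λ k → mulX 1 g k * spow e k m)
        ≈⟨ Σ-dropˡ m _ (zeroˡ _) ⟩
      Σ< m (λ k → g k * spow e (suc k) m)
        ≈⟨ Σ-dropʳ m _ (trans (*-congˡ (spow-below e e0≈0 (suc m) m (ℕₚ.n<1+n m))) (zeroʳ _)) ⟨
      Σ< (suc m) (λ k → g k * Σ< (suc m) (λ i → e i * spow e k (m ∸ i)))
        ≈⟨ Σ-cong (suc m) (λ k _ → *-distribˡ-Σ (suc m) _ _) ⟩
      Σ< (suc m) (λ k → Σ< (suc m) (λ i → g k * (e i * spow e k (m ∸ i))))
        ≈⟨ Σ-comm (suc m) (suc m) _ ⟩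
      Σ< (suc m) (λ i → Σ< (suc m) (λ k → g k * (e i * spow e k (m ∸ i))))
        ≈⟨ Σ-cong (suc m) (λ i _ → trans (Σ-cong (suc m) (λ k _ → solve 3 (λ a b c → a :* (b :* c) := b :* (a :* c)) refl _ _ _))
                                         (sym (*-distribˡ-Σ (suc m) _ _))) ⟩
      Σ< (suc m) (λ i → e i * Σ< (suc m) (λ k → g k * spow e k (m ∸ i)))
        ≈⟨ Σ-cong (suc m) (λ i _ → *-congˡ (comp-truncate g (m ∸ i) (suc m) (s≤s (ℕₚ.m∸n≤m m i)))) ⟩
      Σ< (suc m) (λ i → e i * comp g e (m ∸ i))
        ≈⟨ Σ-reverse (suc m) _ ⟩
      Σ< (suc m) (λ i → e (m ∸ i) * comp g e (m ∸ (m ∸ i)))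
        ≈⟨ Σ-cong (suc m) (λ i i≤m → trans (*-comm _ _) (*-congʳ (reflexive (≡.cong (comp g e) (ℕₚ.m∸[m∸n]≡n (ℕₚ.≤-pred i≤m)))))) ⟩
      Σ< (suc m) (λ i → comp g e i * e (m ∸ i))
        ∎

  Minv-cong : ∀ {f g} → f ≋ g → Minv f ≋ Minv g
  Minv-cong f≋g zero    = refl
  Minv-cong f≋g (suc k) = *-congˡ (*-congˡ (comp-congˡ expm1 f≋g k))

  Minv-≋-mulX : ∀ m g (f : ℕ → Carrier) → (∀ k → k < m → comp g expm1 k ≈ 0#) →
                (∀ j → Minv g (suc (m Nat.+ j)) ≈ f j) → Minv g ≋ mulX (suc m) f
  Minv-≋-mulX m g f below from zero    = refl
  Minv-≋-mulX m g f below from (suc k) with k Nat.<? m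
  ... | yes k<m = trans (*-congˡ (trans (*-congˡ (below k k<m)) (zeroʳ _)))
                        (trans (zeroʳ _) (sym (mulX-below m f k k<m)))
  ... | no  k≮m with ℕₚ.m≤n⇒∃[o]m+o≡n (ℕₚ.≮⇒≥ k≮m)
  ...   | j , ≡.refl = trans (from j) (reflexive (≡.sym (mulX-+ m f j)))

  shiftW-⊙-rec : ∀ f n → (shiftW ⊙ f) (suc n) + (shiftW ⊙ f) n ≈ f n
  shiftW-⊙-rec f n = begin
    (shiftW ⊙ f) (suc n) + (shiftW ⊙ f) n
      ≈⟨ +-cong (trans (Σ-dropˡ (suc n) _ (zeroˡ _)) (Σ-unfoldˡ n _)) (Σ-dropˡ n _ (zeroˡ _)) ⟩
    (1# * f n + Σ< n (λ i → sgn (suc i) * f (n ∸ suc i))) + Σ< n (λ i → sgn i * f (n ∸ suc i))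
      ≈⟨ trans (+-assoc _ _ _) (+-cong (*-identityˡ _) (sym (Σ-distrib-+ n _ _))) ⟩
    f n + Σ< n (λ i → sgn (suc i) * f (n ∸ suc i) + sgn i * f (n ∸ suc i))
      ≈⟨ +-congˡ (Σ-zero n _ (λ i _ → trans (+-congʳ (*-assoc _ _ _)) (-1*x+x≈0 _))) ⟩
    f n + 0#
      ≈⟨ +-identityʳ _ ⟩
    f n
      ∎

  shiftW-pow-suc : ∀ k n → spow shiftW (suc k) (suc n) ≈ spow shiftW k n - spow shiftW (suc k) n
  shiftW-pow-suc k n = x+y≈z⇒x≈z-y (shiftW-⊙-rec (spow shiftW k) n)

  shiftW-pow-below : ∀ k n → n < k → spow shiftW k n ≈ 0#
  shiftW-pow-below = spow-below shiftW refl

  shiftW-pow-diag : ∀ j → spow shiftW j j ≈ 1#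
  shiftW-pow-diag zero    = refl
  shiftW-pow-diag (suc j) = begin
    spow shiftW (suc j) (suc j)
      ≈⟨ shiftW-pow-suc j j ⟩
    spow shiftW j j - spow shiftW (suc j) j
      ≈⟨ +-cong (shiftW-pow-diag j) (-‿cong (shiftW-pow-below (suc j) j (ℕₚ.n<1+n j))) ⟩
    1# - 0#
      ≈⟨ trans (+-congˡ -0#≈0#) (+-identityʳ 1#) ⟩
    1#
      ∎

  shiftW-pow-binomial : ∀ j d → spow shiftW (suc j) (suc j Nat.+ d) ≈ sgn d * ι (binomial j d)
  shiftW-pow-binomial j zero = begin
    spow shiftW (suc j) (suc j Nat.+ 0)   ≈⟨ reflexive (≡.cong (spow shiftW (suc j)) (ℕₚ.+-identityʳ (suc j))) ⟩
    spow shiftW (suc j) (suc j)           ≈⟨ shiftW-pow-diag (suc j) ⟩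
    1#                                    ≈⟨ trans (*-identityˡ _) (ι-binomial-zero j) ⟨
    1# * ι (binomial j 0)                 ∎
    where
    ι-binomial-zero : ∀ j → ι (binomial j 0) ≈ 1#
    ι-binomial-zero zero    = ι1≈1
    ι-binomial-zero (suc j) = ι1≈1
  shiftW-pow-binomial zero (suc d) = begin
    spow shiftW 1 (suc (suc d))              ≈⟨ shiftW-pow-suc 0 (suc d) ⟩
    0# - spow shiftW 1 (suc d)               ≈⟨ trans (x-y≈x+-1*y _ _) (+-identityˡ _) ⟩
    - 1# * spow shiftW 1 (suc d)             ≈⟨ *-congˡ (shiftW-pow-binomial zero d) ⟩
    - 1# * (sgn d * ι 1)                     ≈⟨ *-assoc _ _ _ ⟨
    sgn (suc d) * ι 1                        ∎
  shiftW-pow-binomial (suc j) (suc d) = begin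
    spow shiftW (2+j) (suc (suc j Nat.+ suc d))
      ≈⟨ shiftW-pow-suc (suc j) (suc j Nat.+ suc d) ⟩
    spow shiftW (suc j) (suc j Nat.+ suc d) - spow shiftW (2+j) (suc j Nat.+ suc d)
      ≈⟨ +-cong (shiftW-pow-binomial j (suc d))
                (-‿cong (trans (reflexive (≡.cong (spow shiftW (2+j)) (ℕₚ.+-suc (suc j) d))) (shiftW-pow-binomial (suc j) d))) ⟩
    sgn (suc d) * ι (binomial j (suc d)) - sgn d * ι (binomial (suc j) d)
      ≈⟨ x-y≈x+-1*y _ _ ⟩
    (- 1# * sgn d) * ι (binomial j (suc d)) + - 1# * (sgn d * ι (binomial (suc j) d))
      ≈⟨ solve 4 (λ a s x y → (a :* s) :* x :+ a :* (s :* y) := (a :* s) :* (x :+ y)) refl (- 1#) (sgn d) _ _ ⟩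
    sgn (suc d) * (ι (binomial j (suc d)) + ι (binomial (suc j) d))
      ≈⟨ *-congˡ (ι-homo-+ (binomial j (suc d)) (binomial (suc j) d)) ⟨
    sgn (suc d) * ι (binomial (suc j) (suc d))
      ∎
    where 2+j = suc (suc j)

module SeriesCalculusCharZero {c ℓ} (F : Field c ℓ) (char0 : Series.CharZero F) where
  open Field F hiding (zero)
  open Series F
  open SeriesCalculus F
  open import Algebra.Properties.Ring ring using (-0#≈0#)
  open import Relation.Binary.Reasoning.Setoid setoid
  open import Algebra.Solver.Ring.NaturalCoefficients commutativeSemiring (λ _ _ → nothing)
    using (solve; _:+_; _:*_; _:=_; con)

  ι[n!]≉0 : ∀ n → ¬ (ι (n !) ≈ 0#)
  ι[n!]≉0 n ι[n!]≈0 =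
    char0 (Nat.pred (n !)) (trans (reflexive (≡.cong ι (ℕₚ.suc-pred (n !) {{ℕₚ._!≢0 n}}))) ι[n!]≈0)

  ι1⁻¹≈1 : ι 1 ⁻¹ ≈ 1#
  ι1⁻¹≈1 = sym (⁻¹-unique (ι 1) (char0 0) (trans (*-identityʳ _) ι1≈1))

  ι[1+n]/[1+n]!≈1/n! : ∀ n → ι (suc n) * ι (suc n !) ⁻¹ ≈ ι (n !) ⁻¹
  ι[1+n]/[1+n]!≈1/n! n = ⁻¹-unique (ι (n !)) (ι[n!]≉0 n) (begin
    ι (n !) * (ι (suc n) * ι (suc n !) ⁻¹)   ≈⟨ solve 3 (λ a b c → a :* (b :* c) := (b :* a) :* c) refl _ _ _ ⟩
    (ι (suc n) * ι (n !)) * ι (suc n !) ⁻¹   ≈⟨ *-congʳ (ι-homo-* (suc n) (n !)) ⟨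
    ι (suc n !) * ι (suc n !) ⁻¹             ≈⟨ ⁻¹-inverse _ (ι[n!]≉0 (suc n)) ⟩
    1#                                       ∎)

  ∂-expm1 : ∂ expm1 ≋ (one ⊕ expm1)
  ∂-expm1 zero    = trans (ι[1+n]/[1+n]!≈1/n! 0) (trans ι1⁻¹≈1 (sym (+-identityʳ _)))
  ∂-expm1 (suc n) = trans (ι[1+n]/[1+n]!≈1/n! (suc n)) (sym (+-identityˡ _))

  ∂-spow-expm1 : ∀ k → ∂ (spow expm1 (suc k)) ≋ (ι (suc k) · (spow expm1 k ⊕ spow expm1 (suc k)))
  ∂-spow-expm1 zero n = begin
    ∂ (expm1 ⊙ one) n                 ≈⟨ ∂-cong (⊙-identityʳ expm1) n ⟩
    ∂ expm1 n                         ≈⟨ ∂-expm1 n ⟩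
    one n + expm1 n                   ≈⟨ +-congˡ (⊙-identityʳ expm1 n) ⟨
    one n + (expm1 ⊙ one) n           ≈⟨ trans (*-congʳ ι1≈1) (*-identityˡ _) ⟨
    ι 1 * (one n + (expm1 ⊙ one) n)   ∎
  ∂-spow-expm1 (suc k) n = begin
    ∂ (expm1 ⊙ Eᵏ⁺¹) n
      ≈⟨ ∂-leibniz expm1 Eᵏ⁺¹ n ⟩
    (∂ expm1 ⊙ Eᵏ⁺¹) n + (expm1 ⊙ ∂ Eᵏ⁺¹) n
      ≈⟨ +-cong (trans (⊙-cong {∂ expm1} {one ⊕ expm1} {Eᵏ⁺¹} ∂-expm1 (λ _ → refl) n) (⊙-distribʳ-⊕ one expm1 Eᵏ⁺¹ n))
                (⊙-cong {g = ∂ Eᵏ⁺¹} {ι (suc k) · (spow expm1 k ⊕ Eᵏ⁺¹)} (λ _ → refl) (∂-spow-expm1 k) n) ⟩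
    ((one ⊙ Eᵏ⁺¹) n + Eᵏ⁺² n) + (expm1 ⊙ (ι (suc k) · (spow expm1 k ⊕ Eᵏ⁺¹))) n
      ≈⟨ +-cong (+-congʳ (⊙-identityˡ Eᵏ⁺¹ n))
                (trans (⊙-· (ι (suc k)) expm1 (spow expm1 k ⊕ Eᵏ⁺¹) n) (*-congˡ (⊙-distribˡ-⊕ expm1 (spow expm1 k) Eᵏ⁺¹ n))) ⟩
    (Eᵏ⁺¹ n + Eᵏ⁺² n) + ι (suc k) * (Eᵏ⁺¹ n + Eᵏ⁺² n)
      ≈⟨ solve 3 (λ a b c → (a :+ b) :+ c :* (a :+ b) := (con 1 :+ c) :* (a :+ b)) refl (Eᵏ⁺¹ n) (Eᵏ⁺² n) (ι (suc k)) ⟩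
    ι (suc (suc k)) * (Eᵏ⁺¹ n + Eᵏ⁺² n)
      ∎
    where
    Eᵏ⁺¹ = spow expm1 (suc k)
    Eᵏ⁺² = spow expm1 (suc (suc k))

  ∂-comp-expm1 : ∀ g → ∂ (comp g expm1) ≋ comp (θ g) expm1
  ∂-comp-expm1 g n = begin
    ι (suc n) * Σ< (suc (suc n)) (λ k → g k * spow expm1 k (suc n))
      ≈⟨ *-distribˡ-Σ (suc (suc n)) _ _ ⟩
    Σ< (suc (suc n)) (λ k → ι (suc n) * (g k * spow expm1 k (suc n)))
      ≈⟨ Σ-cong (suc (suc n)) (λ k _ → solve 3 (λ a x y → a :* (x :* y) := x :* (a :* y)) refl _ _ _) ⟩
    Σ< (suc (suc n)) (λ k → g k * ∂ (spow expm1 k) n)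
      ≈⟨ Σ-dropˡ (suc n) _ (trans (*-congˡ (zeroʳ _)) (zeroʳ _)) ⟩
    Σ< (suc n) (λ k → g (suc k) * ∂ (spow expm1 (suc k)) n)
      ≈⟨ Σ-cong (suc n) (λ k _ → trans (*-congˡ (∂-spow-expm1 k n))
           (solve 4 (λ g c x y → g :* (c :* (x :+ y)) := (c :* g) :* x :+ (c :* g) :* y) refl _ _ _ _)) ⟩
    Σ< (suc n) (λ k → ∂ g k * spow expm1 k n + ∂ g k * spow expm1 (suc k) n)
      ≈⟨ Σ-distrib-+ (suc n) _ _ ⟩
    Σ< (suc n) (λ k → ∂ g k * spow expm1 k n) + Σ< (suc n) (λ k → ∂ g k * spow expm1 (suc k) n)
      ≈⟨ +-congˡ (Σ-dropʳ n _ (trans (*-congˡ (spow-below expm1 refl (suc n) n (ℕₚ.n<1+n n))) (zeroʳ _))) ⟩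
    Σ< (suc n) (λ k → ∂ g k * spow expm1 k n) + Σ< n (λ k → ∂ g k * spow expm1 (suc k) n)
      ≈⟨ +-congˡ (Σ-dropˡ n _ (zeroˡ _)) ⟨
    Σ< (suc n) (λ k → ∂ g k * spow expm1 k n) + Σ< (suc n) (λ k → mulX 1 (∂ g) k * spow expm1 k n)
      ≈⟨ comp-distrib-⊕ (∂ g) (mulX 1 (∂ g)) expm1 n ⟨
    comp (θ g) expm1 n
      ∎

  ι-!-*-binomial : ∀ i e → ι (i !) * ι (binomial i e) ≈ ι ((i Nat.+ e) !) * ι (e !) ⁻¹
  ι-!-*-binomial i e = begin
    ι (i !) * ι (binomial i e)
      ≈⟨ *-identityʳ _ ⟨
    (ι (i !) * ι (binomial i e)) * 1#
      ≈⟨ *-congˡ (⁻¹-inverse _ (ι[n!]≉0 e)) ⟨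
    (ι (i !) * ι (binomial i e)) * (ι (e !) * ι (e !) ⁻¹)
      ≈⟨ solve 4 (λ a b c d → (a :* b) :* (c :* d) := (b :* (a :* c)) :* d) refl _ _ _ _ ⟩
    (ι (binomial i e) * (ι (i !) * ι (e !))) * ι (e !) ⁻¹
      ≈⟨ *-congʳ (ι-binomial-! i e) ⟩
    ι ((i Nat.+ e) !) * ι (e !) ⁻¹
      ∎

  Minv-*-shiftW-pow : ∀ g i d → Minv g (suc i) * spow shiftW (suc i) (suc i Nat.+ suc d)
                                ≈ sgn (suc i Nat.+ suc d) * (ι ((i Nat.+ suc d) !) * (comp g expm1 i * expm1 (suc d)))
  Minv-*-shiftW-pow g i d = begin
    (sgn (suc i) * (ι (i !) * P)) * spow shiftW (suc i) (suc i Nat.+ suc d)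
      ≈⟨ *-congˡ (shiftW-pow-binomial i (suc d)) ⟩
    (sgn (suc i) * (ι (i !) * P)) * (sgn (suc d) * ι (binomial i (suc d)))
      ≈⟨ solve 5 (λ s t f b p → (s :* (f :* p)) :* (t :* b) := (s :* t) :* ((f :* b) :* p)) refl _ _ _ _ _ ⟩
    (sgn (suc i) * sgn (suc d)) * ((ι (i !) * ι (binomial i (suc d))) * P)
      ≈⟨ *-cong (sym (sgn-homo-+ (suc i) (suc d))) (*-congʳ (ι-!-*-binomial i (suc d))) ⟩
    sgn (suc i Nat.+ suc d) * ((ι ((i Nat.+ suc d) !) * ι (suc d !) ⁻¹) * P)
      ≈⟨ *-congˡ (solve 3 (λ a b p → (a :* b) :* p := a :* (p :* b)) refl _ _ _) ⟩
    sgn (suc i Nat.+ suc d) * (ι ((i Nat.+ suc d) !) * (P * expm1 (suc d)))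
      ∎
    where P = comp g expm1 i

  Δ₁-Minv : ∀ g → Δ₁ (Minv g) ≋ Minv (mulX 1 g)
  Δ₁-Minv g zero = begin
    (0# + 0# * 1#) - 0#   ≈⟨ +-cong (trans (+-identityˡ _) (zeroˡ _)) -0#≈0# ⟩
    0# + 0#               ≈⟨ +-identityʳ 0# ⟩
    0#                    ∎
  Δ₁-Minv g (suc m) = begin
    comp (Minv g) shiftW (suc m) - Minv g (suc m)
      ≈⟨ +-congʳ (Σ-dropˡ (suc m) _ (zeroˡ _)) ⟩
    (Σ< m t + Minv g (suc m) * spow shiftW (suc m) (suc m)) - Minv g (suc m)
      ≈⟨ +-congʳ (+-congˡ (trans (*-congˡ (shiftW-pow-diag (suc m))) (*-identityʳ _))) ⟩
    (Σ< m t + Minv g (suc m)) - Minv g (suc m)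
      ≈⟨ [x+y]-y≈x _ _ ⟩
    Σ< m t
      ≈⟨ Σ-cong m term ⟩
    Σ< m (λ i → sgn (suc m) * (ι (m !) * (comp g expm1 i * expm1 (m ∸ i))))
      ≈⟨ trans (*-congˡ (*-distribˡ-Σ m _ _)) (*-distribˡ-Σ m _ _) ⟨
    sgn (suc m) * (ι (m !) * Σ< m (λ i → comp g expm1 i * expm1 (m ∸ i)))
      ≈⟨ *-congˡ (*-congˡ (Σ-dropʳ m _ (trans (*-congˡ (reflexive (≡.cong expm1 (ℕₚ.n∸n≡0 m)))) (zeroʳ _)))) ⟨
    sgn (suc m) * (ι (m !) * (comp g expm1 ⊙ expm1) m)
      ≈⟨ *-congˡ (*-congˡ (comp-mulX1 expm1 refl g m)) ⟨
    Minv (mulX 1 g) (suc m)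
      ∎
    where
    t : ℕ → Carrier
    t j = Minv g (suc j) * spow shiftW (suc j) (suc m)
    term : ∀ i → i < m → t i ≈ sgn (suc m) * (ι (m !) * (comp g expm1 i * expm1 (m ∸ i)))
    term i i<m with ℕₚ.m≤n⇒∃[o]m+o≡n i<m
    ... | d , 1+i+d≡m with ≡.trans (ℕₚ.+-suc i d) 1+i+d≡m
    ...   | ≡.refl = trans (Minv-*-shiftW-pow g i d)
                           (*-congˡ (*-congˡ (*-congˡ (reflexive (≡.cong expm1 (≡.sym (ℕₚ.m+n∸m≡n i (suc d))))))))

  -- The recurrences are (e^{αz} z^m)′ = α e^{αz} z^m + m e^{αz} z^(m−1), read coefficientwise.
  module ExpMonomial (α : Carrier) (h : ℕ → Ser)
      (h-0-0   : h 0 0 ≈ 1#)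
      (h-suc-0 : ∀ m → h (suc m) 0 ≈ 0#)
      (h-0-rec : ∀ n → ι (suc n) * h 0 (suc n) ≈ α * h 0 n)
      (h-rec   : ∀ m n → ι (suc n) * h (suc m) (suc n) ≈ α * h (suc m) n + ι (suc m) * h m n)
      where

    h-below : ∀ m n → n < m → h m n ≈ 0#
    h-below (suc m) zero    _         = h-suc-0 m
    h-below (suc m) (suc n) (s≤s n<m) = *-cancelˡ (ι (suc n)) (char0 n) (begin
      ι (suc n) * h (suc m) (suc n)
        ≈⟨ h-rec m n ⟩
      α * h (suc m) n + ι (suc m) * h m n
        ≈⟨ +-cong (*-congˡ (h-below (suc m) n (ℕₚ.m<n⇒m<1+n n<m))) (*-congˡ (h-below m n n<m)) ⟩
      α * 0# + ι (suc m) * 0#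
        ≈⟨ trans (+-cong (zeroʳ _) (zeroʳ _)) (+-identityʳ _) ⟩
      0#
        ≈⟨ zeroʳ _ ⟨
      ι (suc n) * 0#
        ∎)

    expCoeff : ℕ → Carrier
    expCoeff j = pw α j * ι (j !) ⁻¹

    expCoeff-rec : ∀ j → ι (suc j) * expCoeff (suc j) ≈ α * expCoeff j
    expCoeff-rec j = begin
      ι (suc j) * ((α * pw α j) * ι (suc j !) ⁻¹)
        ≈⟨ solve 4 (λ a b c d → a :* ((b :* c) :* d) := (b :* c) :* (a :* d)) refl _ _ _ _ ⟩
      (α * pw α j) * (ι (suc j) * ι (suc j !) ⁻¹)
        ≈⟨ *-congˡ (ι[1+n]/[1+n]!≈1/n! j) ⟩
      (α * pw α j) * ι (j !) ⁻¹
        ≈⟨ *-assoc _ _ _ ⟩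
      α * expCoeff j
        ∎

    h-diag : ∀ m → h m m ≈ 1#
    h-diag zero    = h-0-0
    h-diag (suc m) = *-cancelˡ (ι (suc m)) (char0 m) (begin
      ι (suc m) * h (suc m) (suc m)
        ≈⟨ h-rec m m ⟩
      α * h (suc m) m + ι (suc m) * h m m
        ≈⟨ +-cong (*-congˡ (h-below (suc m) m (ℕₚ.n<1+n m))) (*-congˡ (h-diag m)) ⟩
      α * 0# + ι (suc m) * 1#
        ≈⟨ trans (+-congʳ (zeroʳ _)) (+-identityˡ _) ⟩
      ι (suc m) * 1#
        ∎)

    h-from : ∀ m j → h m (m Nat.+ j) ≈ expCoeff j
    h-from m       zero    = trans (reflexive (≡.cong (h m) (ℕₚ.+-identityʳ m)))
                                   (trans (h-diag m) (sym (trans (*-identityˡ _) ι1⁻¹≈1)))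
    h-from zero    (suc j) = *-cancelˡ (ι (suc j)) (char0 j)
      (trans (h-0-rec j) (trans (*-congˡ (h-from zero j)) (sym (expCoeff-rec j))))
    h-from (suc m) (suc j) = *-cancelˡ (ι (suc m Nat.+ suc j)) (char0 (m Nat.+ suc j)) (begin
      ι (suc (m Nat.+ suc j)) * h (suc m) (suc (m Nat.+ suc j))
        ≈⟨ h-rec m (m Nat.+ suc j) ⟩
      α * h (suc m) (m Nat.+ suc j) + ι (suc m) * h m (m Nat.+ suc j)
        ≈⟨ +-cong (*-congˡ (trans (reflexive (≡.cong (h (suc m)) (ℕₚ.+-suc m j))) (h-from (suc m) j)))
                  (*-congˡ (h-from m (suc j))) ⟩
      α * expCoeff j + ι (suc m) * expCoeff (suc j)
        ≈⟨ +-congʳ (expCoeff-rec j) ⟨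
      ι (suc j) * expCoeff (suc j) + ι (suc m) * expCoeff (suc j)
        ≈⟨ trans (sym (distribʳ _ _ _)) (*-congʳ (trans (+-comm _ _) (sym (ι-homo-+ (suc m) (suc j))))) ⟩
      ι (suc m Nat.+ suc j) * expCoeff (suc j)
        ∎)

module BinomialLogSeries {c ℓ} (F : Field c ℓ) (char0 : Series.CharZero F) (α : Field.Carrier F) where
  open Field F hiding (zero)
  open Series F
  open SeriesCalculus F
  open SeriesCalculusCharZero F char0
  open import Algebra.Properties.Ring ring using (-0#≈0#)
  open import Relation.Binary.Reasoning.Setoid setoid
  open import Algebra.Solver.Ring.NaturalCoefficients commutativeSemiring (λ _ _ → nothing)
    using (solve; _:+_; _:*_; _:=_)

  ∂-logSer : ∀ n → ∂ logSer n ≈ sgn n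
  ∂-logSer n = trans (solve 3 (λ a s v → a :* (s :* v) := s :* (a :* v)) refl (ι (suc n)) (sgn n) _)
                     (trans (*-congˡ (⁻¹-inverse _ (char0 n))) (*-identityʳ _))

  θ-logSer : θ logSer ≋ one
  θ-logSer zero    = trans (+-identityʳ _) (∂-logSer 0)
  θ-logSer (suc n) = trans (+-cong (∂-logSer (suc n)) (∂-logSer n)) (-1*x+x≈0 (sgn n))

  ∂-binSer : ∀ n → ∂ (binSer α) n ≈ binSer α n * (α - ι n)
  ∂-binSer n = begin
    ι (suc n) * ((p * x) * ι (suc n !) ⁻¹)
      ≈⟨ solve 4 (λ a p x v → a :* ((p :* x) :* v) := (p :* x) :* (a :* v)) refl _ p x _ ⟩
    (p * x) * (ι (suc n) * ι (suc n !) ⁻¹)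
      ≈⟨ *-congˡ (ι[1+n]/[1+n]!≈1/n! n) ⟩
    (p * x) * ι (n !) ⁻¹
      ≈⟨ solve 3 (λ p x w → (p :* x) :* w := (p :* w) :* x) refl p x _ ⟩
    (p * ι (n !) ⁻¹) * x
      ∎
    where
    p = Π< n (λ i → α - ι i)
    x = α - ι n

  θ-binSer : θ (binSer α) ≋ (α · binSer α)
  θ-binSer zero = begin
    ∂ (binSer α) 0 + 0#        ≈⟨ +-identityʳ _ ⟩
    ∂ (binSer α) 0             ≈⟨ ∂-binSer 0 ⟩
    binSer α 0 * (α - 0#)      ≈⟨ *-congˡ (trans (+-congˡ -0#≈0#) (+-identityʳ α)) ⟩
    binSer α 0 * α             ≈⟨ *-comm _ _ ⟩
    α * binSer α 0             ∎
  θ-binSer (suc n) = begin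
    ∂ (binSer α) (suc n) + ι (suc n) * u
      ≈⟨ +-congʳ (trans (∂-binSer (suc n)) (*-congˡ (x-y≈x+-1*y _ _))) ⟩
    u * (α + - 1# * ι (suc n)) + ι (suc n) * u
      ≈⟨ solve 4 (λ u a m v → u :* (a :+ m :* v) :+ v :* u := a :* u :+ (m :* (v :* u) :+ v :* u)) refl u α (- 1#) (ι (suc n)) ⟩
    α * u + (- 1# * (ι (suc n) * u) + ι (suc n) * u)
      ≈⟨ trans (+-congˡ (-1*x+x≈0 _)) (+-identityʳ _) ⟩
    α * u
      ∎
    where u = binSer α (suc n)

  G : ℕ → Ser
  G m = binSer α ⊙ spow logSer m

  θ-G-zero : θ (G 0) ≋ (α · G 0)
  θ-G-zero n =
    trans (θ-cong (⊙-identityʳ (binSer α)) n) (trans (θ-binSer n) (*-congˡ (sym (⊙-identityʳ (binSer α) n))))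

  θ-G-suc : ∀ m → θ (G (suc m)) ≋ ((α · G (suc m)) ⊕ (ι (suc m) · G m))
  θ-G-suc m n = trans (θ-⊙-eigen θ-binSer (spow logSer (suc m)) n) (+-congˡ (trans
    (⊙-cong {binSer α} {binSer α} {θ (spow logSer (suc m))} {ι (suc m) · spow logSer m} (λ _ → refl) (θ-spow θ-logSer m) n)
    (⊙-· (ι (suc m)) (binSer α) (spow logSer m) n)))

  G-zero-0 : G 0 0 ≈ 1#
  G-zero-0 = trans (⊙-identityʳ (binSer α) 0) (trans (*-identityˡ _) ι1⁻¹≈1)

  G-suc-0 : ∀ m → G (suc m) 0 ≈ 0#
  G-suc-0 m = trans (+-identityˡ _) (trans (*-congˡ (spow-below logSer refl (suc m) 0 (s≤s z≤n))) (zeroʳ _))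

  -- H m = G m (e^z − 1) = e^{αz} z^m
  H : ℕ → Ser
  H m = comp (G m) expm1

  H-zero-rec : ∀ n → ι (suc n) * H 0 (suc n) ≈ α * H 0 n
  H-zero-rec n = trans (∂-comp-expm1 (G 0) n) (trans (comp-congˡ expm1 θ-G-zero n) (comp-· α (G 0) expm1 n))

  H-suc-rec : ∀ m n → ι (suc n) * H (suc m) (suc n) ≈ α * H (suc m) n + ι (suc m) * H m n
  H-suc-rec m n = trans (∂-comp-expm1 (G (suc m)) n) (trans (comp-congˡ expm1 (θ-G-suc m) n)
    (trans (comp-distrib-⊕ _ _ expm1 n) (+-cong (comp-· α (G (suc m)) expm1 n) (comp-· _ (G m) expm1 n))))

  open ExpMonomial α H (trans (comp-at-0 (G 0) expm1) G-zero-0) (λ m → trans (comp-at-0 (G (suc m)) expm1) (G-suc-0 m))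
                       H-zero-rec H-suc-rec

  binScaled-neg : ∀ m j → ι (m !) * binScaled (- ι (suc m)) α j ≈ sgn j * (ι ((m Nat.+ j) !) * expCoeff j)
  binScaled-neg m j = begin
    ι (m !) * ((Π< j (λ i → - ι (suc m) - ι i) * ι (j !) ⁻¹) * pw α j)
      ≈⟨ *-congˡ (*-congʳ (*-congʳ (Π-negate (ι (suc m)) j))) ⟩
    ι (m !) * (((sgn j * rising (ι (suc m)) j) * ι (j !) ⁻¹) * pw α j)
      ≈⟨ solve 5 (λ f s r w a → f :* (((s :* r) :* w) :* a) := s :* ((f :* r) :* (a :* w))) refl _ _ _ _ _ ⟩
    sgn j * ((ι (m !) * rising (ι (suc m)) j) * expCoeff j)
      ≈⟨ *-congˡ (*-congʳ (ι-!-*-rising m j)) ⟩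
    sgn j * (ι ((m Nat.+ j) !) * expCoeff j)
      ∎

  Δ₁-R : ∀ m → Δ₁ (R α (suc (suc m))) ≋ rhs α (suc (suc m))
  Δ₁-R m = ≋-trans (Δ₁-Minv (divX (G (suc m))))
          (≋-trans (Minv-cong (mulX1-divX (G (suc m)) (G-suc-0 m)))
                   (Minv-≋-mulX (suc m) (G (suc m)) _ (h-below (suc m)) coefficient))
    where
    s = suc (suc m)
    coefficient : ∀ j → Minv (G (suc m)) (suc (suc m Nat.+ j)) ≈ (sgn s * ι (suc m !)) * binScaled (- ι s) α j
    coefficient j = begin
      sgn (s Nat.+ j) * (ι ((suc m Nat.+ j) !) * H (suc m) (suc m Nat.+ j))
        ≈⟨ *-cong (sgn-homo-+ s j) (*-congˡ (h-from (suc m) j)) ⟩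
      (sgn s * sgn j) * (ι ((suc m Nat.+ j) !) * expCoeff j)
        ≈⟨ *-assoc _ _ _ ⟩
      sgn s * (sgn j * (ι ((suc m Nat.+ j) !) * expCoeff j))
        ≈⟨ *-congˡ (binScaled-neg (suc m) j) ⟨
      sgn s * (ι (suc m !) * binScaled (- ι s) α j)
        ≈⟨ *-assoc _ _ _ ⟨
      (sgn s * ι (suc m !)) * binScaled (- ι s) α j
        ∎

  Δ₁-R₁ : Δ₁ (R₁ α) ≋ rhs₁ α
  Δ₁-R₁ = ≋-trans (Δ₁-Minv (divX (binSer α ⊖ one)))
         (≋-trans (Minv-cong (mulX1-divX (binSer α ⊖ one) B⊖1-at-0))
                  (Minv-≋-mulX 1 (binSer α ⊖ one) _ below coefficient))
    where
    B⊖1-at-0 : (binSer α ⊖ one) 0 ≈ 0#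
    B⊖1-at-0 = trans (+-congʳ (trans (*-identityˡ _) ι1⁻¹≈1)) (-‿inverseʳ 1#)
    below : ∀ k → k < 1 → comp (binSer α ⊖ one) expm1 k ≈ 0#
    below zero    _        = trans (comp-at-0 (binSer α ⊖ one) expm1) B⊖1-at-0
    below (suc k) (s≤s ())
    B⊖1≋G₀-1 : (binSer α ⊖ one) ≋ (G 0 ⊕ (- 1# · one))
    B⊖1≋G₀-1 n = trans (x-y≈x+-1*y _ _) (+-congʳ (sym (⊙-identityʳ (binSer α) n)))
    comp-B⊖1 : ∀ k → comp (binSer α ⊖ one) expm1 (suc k) ≈ H 0 (suc k)
    comp-B⊖1 k = begin
      comp (binSer α ⊖ one) expm1 (suc k)
        ≈⟨ comp-congˡ expm1 B⊖1≋G₀-1 (suc k) ⟩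
      comp (G 0 ⊕ (- 1# · one)) expm1 (suc k)
        ≈⟨ trans (comp-distrib-⊕ _ _ expm1 (suc k)) (+-congˡ (comp-· (- 1#) one expm1 (suc k))) ⟩
      H 0 (suc k) + - 1# * comp one expm1 (suc k)
        ≈⟨ +-congˡ (trans (*-congˡ (comp-one expm1 (suc k))) (zeroʳ _)) ⟩
      H 0 (suc k) + 0#
        ≈⟨ +-identityʳ _ ⟩
      H 0 (suc k)
        ∎
    coefficient : ∀ j → Minv (binSer α ⊖ one) (suc (suc j)) ≈ α * binScaled (- 1#) α j
    coefficient j = begin
      sgn (suc (suc j)) * (ι (suc j !) * comp (binSer α ⊖ one) expm1 (suc j))
        ≈⟨ *-cong (sgn-suc-suc j) (*-cong (ι-homo-* (suc j) (j !)) (trans (comp-B⊖1 j) (h-from 0 (suc j)))) ⟩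
      sgn j * ((ι (suc j) * ι (j !)) * expCoeff (suc j))
        ≈⟨ *-congˡ (solve 3 (λ a b c → (a :* b) :* c := b :* (a :* c)) refl _ _ _) ⟩
      sgn j * (ι (j !) * (ι (suc j) * expCoeff (suc j)))
        ≈⟨ *-congˡ (*-congˡ (expCoeff-rec j)) ⟩
      sgn j * (ι (j !) * (α * expCoeff j))
        ≈⟨ solve 4 (λ s f a e → s :* (f :* (a :* e)) := a :* (s :* (f :* e))) refl _ _ _ _ ⟩
      α * (sgn j * (ι (j !) * expCoeff j))
        ≈⟨ *-congˡ (binScaled-neg 0 j) ⟨
      α * (ι 1 * binScaled (- ι 1) α j)
        ≈⟨ *-congˡ (trans (*-congʳ ι1≈1) (trans (*-identityˡ _) (*-congʳ (*-congʳ (Π-cong j (λ i → +-congʳ (-‿cong ι1≈1))))))) ⟩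
      α * binScaled (- 1#) α j
        ∎

proposition5p4 : ∀ {c ℓ} (F : Field c ℓ) → Series.CharZero F → (α : Field.Carrier F) →
    let open Series F in
      (Δ₁ (R₁ α) ≋ rhs₁ α) × (∀ (s : ℕ) → 2 ≤ s → Δ₁ (R α s) ≋ rhs α s)
proposition5p4 F char0 α = Δ₁-R₁ , λ { (suc (suc m)) (s≤s (s≤s _)) → Δ₁-R m }
  where open BinomialLogSeries F char0 α
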